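{- Let $t$ be a term of $\mathsf{RSLR}$ and suppose $\pi$ is a derivation of $t\Rightarrow\mathscr{D}$, where $\mathscr{D}=\{M_1^{\alpha_1},\ldots,M_n^{\alpha_n}\}$ (i.e. $\mathscr{D}$ assigns probability $\alpha_i>0$ to the term $M_i$ and $0$ to all other terms). Suppose that for every $i$ there is a derivation $\rho_i$ of $M_i\Rightarrow\mathscr{E}_i$. Then there is a derivation $\sigma$ of $t\Rightarrow\sum_i\alpha_i\mathscr{E}_i$ with $|\sigma|\le|\pi|+\max_i|\rho_i|$.
   Context: $\mathsf{RSLR}$ terms: $t::=x\mid c\mid ts\mid\lambda x:aA.t\mid\mathtt{case}_A\,t\ \mathtt{zero}\ s\ \mathtt{even}\ r\ \mathtt{odd}\ q\mid\mathtt{recursion}_A\,t\,s\,r$, with aspects $a\in\{\square,\blacksquare\}$, types $A::=\mathbf{N}\mid aA\rightarrow A$ ($H$ ranging over types other than $\mathbf{N}$), constants $c::=n\mid S_0\mid S_1\mid P\mid\mathtt{rand}$ ($n$ numerals); $t[x:=s]$ is substitution. One-step reduction $t\rightarrow t_1,\ldots,t_n$ ($n\in\{1,2\}$) relates a term to a sequence of terms; its axioms ($n$ numerals): $\mathtt{case}_A\,0\ \mathtt{zero}\ t\ \mathtt{even}\ s\ \mathtt{odd}\ r\rightarrow t$; $\mathtt{case}_A\,(S_0n)\ldots\rightarrow s$; $\mathtt{case}_A\,(S_1n)\ldots\rightarrow r$; $\mathtt{recursion}_A\,0\,g\,f\rightarrow g$; $\mathtt{recursion}_A\,n\,g\,f\rightarrow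 fn(\mathtt{recursion}_A\lfloor n/2\rfloor gf)$ ($n\ge1$); $S_0n\rightarrow2n$; $S_1n\rightarrow2n+1$; $P0\rightarrow0$; $Pn\rightarrow\lfloor n/2\rfloor$; $(\lambda x:a\mathbf{N}.t)n\rightarrow t[x:=n]$; $(\lambda x:aH.t)s\rightarrow t[x:=s]$; $(\lambda x:aA.t)sr\rightarrow(\lambda x:aA.tr)s$; $\mathtt{rand}\rightarrow0,1$; closed under all contexts except the second and third arguments of $\mathtt{recursion}$. The relation $t\Rightarrow\mathscr{D}$ between terms and probability distributions on terms is defined by the rules: $t\Rightarrow\mathscr{D}_t$ for every term $t$ (axiom; $\mathscr{D}_t$ gives $t$ probability $1$); if $t\rightarrow t_1,\ldots,t_n$ and $t_i\Rightarrow\mathscr{D}_i$ for each $i$, then $t\Rightarrow\sum_{i=1}^n\frac1n\mathscr{D}_i$. The size of a derivation is $0$ if it is the axiom, and $\max_i|t_i\Rightarrow\mathscr{D}_i|+1$ (the maximum over the sizes of its immediate subderivations, plus one) otherwise. -}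

module Defs where

open import Data.Nat as ℕ using (ℕ; zero; suc; _⊔_; ⌊_/2⌋; _≡ᵇ_; _<ᵇ_)
open import Data.Bool using (Bool; true; false; _∧_; if_then_else_)
open import Data.Fin using (Fin) renaming (zero to fz; suc to fs)
open import Data.Rational using (ℚ; 0ℚ; 1ℚ; ½; _+_; _*_)

-- Syntax of RSLR (variables are de Bruijn indices)

data Aspect : Set where
  □ ■ : Aspect

data Ty : Set where
  N   : Ty
  arr : Aspect → Ty → Ty → Ty

data Const : Set where
  num  : ℕ → Const
  S0 S1 P rand : Const

data Term : Set where
  var       : ℕ → Term
  con       : Const → Term
  app       : Term → Term → Term
  lam       : Aspect → Ty → Term → Term
  case      : Ty → Term → Term → Term → Term → Term   -- case_A t zero s even r odd q
  recursion : Ty → Term → Term → Term → Term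

nm : ℕ → Term
nm n = con (num n)

shift : ℕ → Term → Term
shift k (var x) = if x <ᵇ k then var x else var (suc x)
shift k (con c) = con c
shift k (app t s) = app (shift k t) (shift k s)
shift k (lam a A t) = lam a A (shift (suc k) t)
shift k (case A t s r q) = case A (shift k t) (shift k s) (shift k r) (shift k q)
shift k (recursion A t s r) = recursion A (shift k t) (shift k s) (shift k r)

substAt : ℕ → Term → Term → Term
substAt k u (var x) =
  if x ≡ᵇ k then u else (if x <ᵇ k then var x else var (ℕ.pred x))
substAt k u (con c) = con c
substAt k u (app t s) = app (substAt k u t) (substAt k u s)
substAt k u (lam a A t) = lam a A (substAt (suc k) (shift 0 u) t)
substAt k u (case A t s r q) =
  case A (substAt k u t) (substAt k u s) (substAt k u r) (substAt k u q)
substAt k u (recursion A t s r) =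
  recursion A (substAt k u t) (substAt k u s) (substAt k u r)

_[0:=_] : Term → Term → Term
t [0:= s ] = substAt 0 s t

data Res : Set where
  one : Term → Res
  two : Term → Term → Res

mapRes : (Term → Term) → Res → Res
mapRes f (one t) = one (f t)
mapRes f (two t s) = two (f t) (f s)

-- one-hole contexts: all contexts except the 2nd and 3rd argument of recursion
data Ctx : Set where
  hole   : Ctx
  appL   : Ctx → Term → Ctx
  appR   : Term → Ctx → Ctx
  lamC   : Aspect → Ty → Ctx → Ctx
  caseT  : Ty → Ctx → Term → Term → Term → Ctx
  caseZ  : Ty → Term → Ctx → Term → Term → Ctx
  caseE  : Ty → Term → Term → Ctx → Term → Ctx
  caseO  : Ty → Term → Term → Term → Ctx → Ctx
  recC   : Ty → Ctx → Term → Term → Ctx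

plug : Ctx → Term → Term
plug hole u = u
plug (appL C s) u = app (plug C u) s
plug (appR t C) u = app t (plug C u)
plug (lamC a A C) u = lam a A (plug C u)
plug (caseT A C s r q) u = case A (plug C u) s r q
plug (caseZ A t C r q) u = case A t (plug C u) r q
plug (caseE A t s C q) u = case A t s (plug C u) q
plug (caseO A t s r C) u = case A t s r (plug C u)
plug (recC A C s r) u = recursion A (plug C u) s r

data _⟶_ : Term → Res → Set where
  case-zero : ∀ {A t s r} → case A (nm 0) t s r ⟶ one t
  case-even : ∀ {A n t s r} → case A (app (con S0) (nm n)) t s r ⟶ one s
  case-odd  : ∀ {A n t s r} → case A (app (con S1) (nm n)) t s r ⟶ one r
  rec-zero  : ∀ {A g f} → recursion A (nm 0) g f ⟶ one g
  rec-suc   : ∀ {A n g f} →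
              recursion A (nm (suc n)) g f ⟶
                one (app (app f (nm (suc n))) (recursion A (nm ⌊ suc n /2⌋) g f))
  s0        : ∀ {n} → app (con S0) (nm n) ⟶ one (nm (2 ℕ.* n))
  s1        : ∀ {n} → app (con S1) (nm n) ⟶ one (nm (suc (2 ℕ.* n)))
  p-zero    : app (con P) (nm 0) ⟶ one (nm 0)
  p-num     : ∀ {n} → app (con P) (nm n) ⟶ one (nm ⌊ n /2⌋)
  beta-N    : ∀ {a t n} → app (lam a N t) (nm n) ⟶ one (t [0:= nm n ])
  beta-H    : ∀ {a b B C t s} → app (lam a (arr b B C) t) s ⟶ one (t [0:= s ])
  assoc     : ∀ {a A t s r} →
              app (app (lam a A t) s) r ⟶ one (app (lam a A (app t (shift 0 r))) s)
  rand      : con rand ⟶ two (nm 0) (nm 1)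
  ctx       : ∀ {t ts} (C : Ctx) → t ⟶ ts → plug C t ⟶ mapRes (plug C) ts

eqA : Aspect → Aspect → Bool
eqA □ □ = true
eqA ■ ■ = true
eqA _ _ = false

eqTy : Ty → Ty → Bool
eqTy N N = true
eqTy (arr a A B) (arr b C D) = eqA a b ∧ eqTy A C ∧ eqTy B D
eqTy _ _ = false

eqC : Const → Const → Bool
eqC (num n) (num m) = n ≡ᵇ m
eqC S0 S0 = true
eqC S1 S1 = true
eqC P P = true
eqC rand rand = true
eqC _ _ = false

eqT : Term → Term → Bool
eqT (var x) (var y) = x ≡ᵇ y
eqT (con c) (con d) = eqC c d
eqT (app t s) (app t' s') = eqT t t' ∧ eqT s s'
eqT (lam a A t) (lam b B u) = eqA a b ∧ eqTy A B ∧ eqT t u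
eqT (case A t s r q) (case B t' s' r' q') =
  eqTy A B ∧ eqT t t' ∧ eqT s s' ∧ eqT r r' ∧ eqT q q'
eqT (recursion A t s r) (recursion B t' s' r') =
  eqTy A B ∧ eqT t t' ∧ eqT s s' ∧ eqT r r'
eqT _ _ = false

Dist : Set
Dist = Term → ℚ

dirac : Term → Dist
dirac t u = if eqT t u then 1ℚ else 0ℚ

half+ : Dist → Dist → Dist
half+ D E u = ½ * D u + ½ * E u

data _⇒_ : Term → Dist → Set where
  axiom : ∀ {t} → t ⇒ dirac t
  step1 : ∀ {t t₁ D} → t ⟶ one t₁ → t₁ ⇒ D → t ⇒ D
  step2 : ∀ {t t₁ t₂ D₁ D₂} → t ⟶ two t₁ t₂ → t₁ ⇒ D₁ → t₂ ⇒ D₂ →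
          t ⇒ half+ D₁ D₂

size : ∀ {t D} → t ⇒ D → ℕ
size axiom = 0
size (step1 _ d) = suc (size d)
size (step2 _ d e) = suc (size d ⊔ size e)

sumQ : (n : ℕ) → (Fin n → ℚ) → ℚ
sumQ zero f = 0ℚ
sumQ (suc n) f = f fz + sumQ n (λ i → f (fs i))

maxN : (n : ℕ) → (Fin n → ℕ) → ℕ
maxN zero f = 0
maxN (suc n) f = f fz ⊔ maxN n (λ i → f (fs i))

mix : (n : ℕ) → (Fin n → ℚ) → (Fin n → Dist) → Dist
mix n α E u = sumQ n (λ i → α i * E i u)

-- At a leaf t ⇒ 𝒟_t the term t is in the support of 𝒟_t, so t = Mₖ for some k,
-- and ρₖ is already the required derivation: by injectivity of M, Σᵢ 𝒟_t(Mᵢ) 𝓔ᵢ = 𝓔ₖ.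
-- At an inner node the support hypothesis passes to the children, because distributions are
-- non-negative and so a zero of ½𝒟₁ + ½𝒟₂ is a zero of both; the grafted derivations are then
-- recombined by the same rule, using that 𝒟 ↦ Σᵢ 𝒟(Mᵢ) 𝓔ᵢ is linear. Each leaf of π is
-- replaced by some ρₖ, which bounds the size.
module Submission where

open import Defs
open import Data.Nat using (ℕ; _≤_; _+_)
open import Data.Fin using (Fin)
open import Data.Product using (Σ; _×_)
open import Data.Rational using (ℚ; 0ℚ; _<_)
open import Relation.Binary.PropositionalEquality using (_≡_; _≢_)

open import Algebra.Bundles using (CommutativeMonoid)
open import Data.Bool using (true; false; _∧_; T)
open import Data.Bool.Properties using (T?)
open import Data.Empty using (⊥-elim)
open import Data.Fin using () renaming (zero to fz; suc to fs)
open import Data.Fin.Properties using (any?; suc-injective)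
open import Data.Nat using (zero; suc; _⊔_; s≤s)
open import Data.Nat.Properties as ℕₚ using (≡ᵇ⇒≡; ≡⇒≡ᵇ; m≤m⊔n; m≤n⊔m; ⊔-mono-≤; +-distribʳ-⊔)
open import Data.Product using (_,_; proj₁; proj₂)
open import Data.Rational using (½; 1ℚ; _*_) renaming (_+_ to _+ℚ_; _≤_ to _≤ℚ_)
open import Data.Rational.Properties as ℚₚ
  using (+-identityˡ; +-identityʳ; +-comm; +-monoʳ-≤; ≤-antisym; *-identityˡ; *-assoc;
         *-distribˡ-+; *-distribʳ-+; *-zeroˡ; *-zeroʳ; *-monoˡ-≤-nonNeg)
open import Function using (_∘_)
open import Relation.Binary.Definitions using (DecidableEquality)
open import Relation.Binary.PropositionalEquality using (refl; sym; trans; cong; cong₂; module ≡-Reasoning)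
open import Relation.Nullary using (yes; no)
open import Relation.Nullary.Decidable using (map′)
open import Algebra.Properties.CommutativeSemigroup
  (CommutativeMonoid.commutativeSemigroup ℚₚ.+-0-commutativeMonoid) using (interchange)

∧-split : ∀ a {b} → T (a ∧ b) → T a × T b
∧-split true p = _ , p

∧-intro : ∀ {a b} → T a → T b → T (a ∧ b)
∧-intro {true} _ q = q

eqA-sound : ∀ a b → T (eqA a b) → a ≡ b
eqA-sound □ □ _ = refl
eqA-sound ■ ■ _ = refl

eqTy-sound : ∀ A B → T (eqTy A B) → A ≡ B
eqTy-sound N N _ = refl
eqTy-sound (arr a A B) (arr b C D) p with ∧-split (eqA a b) p
... | pa , p′ with ∧-split (eqTy A C) p′
... | pA , pB rewrite eqA-sound a b pa | eqTy-sound A C pA | eqTy-sound B D pB = refl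

eqC-sound : ∀ c d → T (eqC c d) → c ≡ d
eqC-sound (num n) (num m) p = cong num (≡ᵇ⇒≡ n m p)
eqC-sound S0 S0 _ = refl
eqC-sound S1 S1 _ = refl
eqC-sound P P _ = refl
eqC-sound rand rand _ = refl
eqC-sound (num _) S0 ()
eqC-sound (num _) S1 ()
eqC-sound (num _) P ()
eqC-sound (num _) rand ()
eqC-sound S0 (num _) ()
eqC-sound S0 S1 ()
eqC-sound S0 P ()
eqC-sound S0 rand ()
eqC-sound S1 (num _) ()
eqC-sound S1 S0 ()
eqC-sound S1 P ()
eqC-sound S1 rand ()
eqC-sound P (num _) ()
eqC-sound P S0 ()
eqC-sound P S1 ()
eqC-sound P rand ()
eqC-sound rand (num _) ()
eqC-sound rand S0 ()
eqC-sound rand S1 ()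
eqC-sound rand P ()

eqT-sound : ∀ t u → T (eqT t u) → t ≡ u
eqT-sound (var x) (var y) p = cong var (≡ᵇ⇒≡ x y p)
eqT-sound (con c) (con d) p = cong con (eqC-sound c d p)
eqT-sound (app t s) (app t′ s′) p with ∧-split (eqT t t′) p
... | pt , ps = cong₂ app (eqT-sound t t′ pt) (eqT-sound s s′ ps)
eqT-sound (lam a A t) (lam b B u) p with ∧-split (eqA a b) p
... | pa , p′ with ∧-split (eqTy A B) p′
... | pA , pt rewrite eqA-sound a b pa | eqTy-sound A B pA | eqT-sound t u pt = refl
eqT-sound (case A t s r q) (case B t′ s′ r′ q′) p with ∧-split (eqTy A B) p
... | pA , p₁ with ∧-split (eqT t t′) p₁
... | pt , p₂ with ∧-split (eqT s s′) p₂
... | ps , p₃ with ∧-split (eqT r r′) p₃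
... | pr , pq
  rewrite eqTy-sound A B pA | eqT-sound t t′ pt | eqT-sound s s′ ps
        | eqT-sound r r′ pr | eqT-sound q q′ pq = refl
eqT-sound (recursion A t s r) (recursion B t′ s′ r′) p with ∧-split (eqTy A B) p
... | pA , p₁ with ∧-split (eqT t t′) p₁
... | pt , p₂ with ∧-split (eqT s s′) p₂
... | ps , pr
  rewrite eqTy-sound A B pA | eqT-sound t t′ pt | eqT-sound s s′ ps | eqT-sound r r′ pr = refl
eqT-sound (var _) (con _) ()
eqT-sound (var _) (app _ _) ()
eqT-sound (var _) (lam _ _ _) ()
eqT-sound (var _) (case _ _ _ _ _) ()
eqT-sound (var _) (recursion _ _ _ _) ()
eqT-sound (con _) (var _) ()
eqT-sound (con _) (app _ _) ()
eqT-sound (con _) (lam _ _ _) ()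
eqT-sound (con _) (case _ _ _ _ _) ()
eqT-sound (con _) (recursion _ _ _ _) ()
eqT-sound (app _ _) (var _) ()
eqT-sound (app _ _) (con _) ()
eqT-sound (app _ _) (lam _ _ _) ()
eqT-sound (app _ _) (case _ _ _ _ _) ()
eqT-sound (app _ _) (recursion _ _ _ _) ()
eqT-sound (lam _ _ _) (var _) ()
eqT-sound (lam _ _ _) (con _) ()
eqT-sound (lam _ _ _) (app _ _) ()
eqT-sound (lam _ _ _) (case _ _ _ _ _) ()
eqT-sound (lam _ _ _) (recursion _ _ _ _) ()
eqT-sound (case _ _ _ _ _) (var _) ()
eqT-sound (case _ _ _ _ _) (con _) ()
eqT-sound (case _ _ _ _ _) (app _ _) ()
eqT-sound (case _ _ _ _ _) (lam _ _ _) ()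
eqT-sound (case _ _ _ _ _) (recursion _ _ _ _) ()
eqT-sound (recursion _ _ _ _) (var _) ()
eqT-sound (recursion _ _ _ _) (con _) ()
eqT-sound (recursion _ _ _ _) (app _ _) ()
eqT-sound (recursion _ _ _ _) (lam _ _ _) ()
eqT-sound (recursion _ _ _ _) (case _ _ _ _ _) ()

eqA-refl : ∀ a → T (eqA a a)
eqA-refl □ = _
eqA-refl ■ = _

eqTy-refl : ∀ A → T (eqTy A A)
eqTy-refl N = _
eqTy-refl (arr a A B) = ∧-intro (eqA-refl a) (∧-intro (eqTy-refl A) (eqTy-refl B))

eqC-refl : ∀ c → T (eqC c c)
eqC-refl (num n) = ≡⇒≡ᵇ n n refl
eqC-refl S0 = _
eqC-refl S1 = _
eqC-refl P = _
eqC-refl rand = _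

eqT-refl : ∀ t → T (eqT t t)
eqT-refl (var x) = ≡⇒≡ᵇ x x refl
eqT-refl (con c) = eqC-refl c
eqT-refl (app t s) = ∧-intro (eqT-refl t) (eqT-refl s)
eqT-refl (lam a A t) = ∧-intro (eqA-refl a) (∧-intro (eqTy-refl A) (eqT-refl t))
eqT-refl (case A t s r q) =
  ∧-intro (eqTy-refl A) (∧-intro (eqT-refl t) (∧-intro (eqT-refl s) (∧-intro (eqT-refl r) (eqT-refl q))))
eqT-refl (recursion A t s r) =
  ∧-intro (eqTy-refl A) (∧-intro (eqT-refl t) (∧-intro (eqT-refl s) (eqT-refl r)))

_≟ᵀ_ : DecidableEquality Term
t ≟ᵀ u = map′ (eqT-sound t u) (λ { refl → eqT-refl t }) (T? (eqT t u))

dirac-self : ∀ t → dirac t t ≡ 1ℚ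
dirac-self t with eqT t t | eqT-refl t
... | true | _ = refl

dirac-≢ : ∀ {t u} → t ≢ u → dirac t u ≡ 0ℚ
dirac-≢ {t} {u} t≢u with eqT t u | eqT-sound t u
... | true | sound = ⊥-elim (t≢u (sound _))
... | false | _ = refl

p+q≡0⇒p≡0 : ∀ {p q} → 0ℚ ≤ℚ p → 0ℚ ≤ℚ q → p +ℚ q ≡ 0ℚ → p ≡ 0ℚ
p+q≡0⇒p≡0 {p} {q} 0≤p 0≤q p+q≡0 = ≤-antisym p≤0 0≤p
  where
  open ℚₚ.≤-Reasoning
  p≤0 : p ≤ℚ 0ℚ
  p≤0 = begin
    p        ≡⟨ sym (+-identityʳ p) ⟩
    p +ℚ 0ℚ  ≤⟨ +-monoʳ-≤ p 0≤q ⟩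
    p +ℚ q   ≡⟨ p+q≡0 ⟩
    0ℚ       ∎

½*p≡0⇒p≡0 : ∀ {p} → ½ * p ≡ 0ℚ → p ≡ 0ℚ
½*p≡0⇒p≡0 {p} ½p≡0 = begin
  p             ≡⟨ sym (*-identityˡ p) ⟩
  (2ℚ * ½) * p  ≡⟨ *-assoc 2ℚ ½ p ⟩
  2ℚ * (½ * p)  ≡⟨ cong (2ℚ *_) ½p≡0 ⟩
  2ℚ * 0ℚ       ≡⟨ *-zeroʳ 2ℚ ⟩
  0ℚ            ∎
  where
  open ≡-Reasoning
  -- 2ℚ * ½ computes to 1ℚ, which the first step uses.
  2ℚ : ℚ
  2ℚ = 1ℚ +ℚ 1ℚ

½*-nonNeg : ∀ {p} → 0ℚ ≤ℚ p → 0ℚ ≤ℚ ½ * p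
½*-nonNeg 0≤p = *-monoˡ-≤-nonNeg ½ 0≤p

½+½≡0⇒≡0 : ∀ {p q} → 0ℚ ≤ℚ p → 0ℚ ≤ℚ q → ½ * p +ℚ ½ * q ≡ 0ℚ → p ≡ 0ℚ × q ≡ 0ℚ
½+½≡0⇒≡0 {p} {q} 0≤p 0≤q sum≡0 =
    ½*p≡0⇒p≡0 (p+q≡0⇒p≡0 (½*-nonNeg 0≤p) (½*-nonNeg 0≤q) sum≡0)
  , ½*p≡0⇒p≡0 (p+q≡0⇒p≡0 (½*-nonNeg 0≤q) (½*-nonNeg 0≤p) (trans (+-comm (½ * q) (½ * p)) sum≡0))

⇒-nonNeg : ∀ {t D} → t ⇒ D → ∀ u → 0ℚ ≤ℚ D u
⇒-nonNeg (axiom {t}) u with eqT t u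
... | true = ℚₚ.nonNegative⁻¹ 1ℚ
... | false = ℚₚ.≤-refl
⇒-nonNeg (step1 _ π) u = ⇒-nonNeg π u
⇒-nonNeg (step2 _ π₁ π₂) u = ℚₚ.+-mono-≤ (½*-nonNeg (⇒-nonNeg π₁ u)) (½*-nonNeg (⇒-nonNeg π₂ u))

sumQ-cong : ∀ n {f g : Fin n → ℚ} → (∀ i → f i ≡ g i) → sumQ n f ≡ sumQ n g
sumQ-cong zero f≗g = refl
sumQ-cong (suc n) f≗g = cong₂ _+ℚ_ (f≗g fz) (sumQ-cong n (λ i → f≗g (fs i)))

sumQ-zero : ∀ n {f : Fin n → ℚ} → (∀ i → f i ≡ 0ℚ) → sumQ n f ≡ 0ℚ
sumQ-zero zero f≗0 = refl
sumQ-zero (suc n) f≗0 = cong₂ _+ℚ_ (f≗0 fz) (sumQ-zero n (λ i → f≗0 (fs i)))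

sumQ-single : ∀ n (f : Fin n → ℚ) k → (∀ i → i ≢ k → f i ≡ 0ℚ) → sumQ n f ≡ f k
sumQ-single (suc n) f fz f≗0 =
  trans (cong (f fz +ℚ_) (sumQ-zero n (λ i → f≗0 (fs i) λ ()))) (+-identityʳ (f fz))
sumQ-single (suc n) f (fs k) f≗0 =
  trans (cong₂ _+ℚ_ (f≗0 fz λ ()) (sumQ-single n (f ∘ fs) k (λ i i≢k → f≗0 (fs i) (i≢k ∘ suc-injective))))
        (+-identityˡ (f (fs k)))

sumQ-+ : ∀ n (f g : Fin n → ℚ) → sumQ n (λ i → f i +ℚ g i) ≡ sumQ n f +ℚ sumQ n g
sumQ-+ zero f g = refl
sumQ-+ (suc n) f g =
  trans (cong (f fz +ℚ g fz +ℚ_) (sumQ-+ n (f ∘ fs) (g ∘ fs)))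
        (interchange (f fz) (g fz) (sumQ n (f ∘ fs)) (sumQ n (g ∘ fs)))

*-distribˡ-sumQ : ∀ n c (f : Fin n → ℚ) → c * sumQ n f ≡ sumQ n (λ i → c * f i)
*-distribˡ-sumQ zero c f = *-zeroʳ c
*-distribˡ-sumQ (suc n) c f =
  trans (*-distribˡ-+ c (f fz) (sumQ n (f ∘ fs))) (cong (c * f fz +ℚ_) (*-distribˡ-sumQ n c (f ∘ fs)))

≤-maxN : ∀ n (f : Fin n → ℕ) k → f k ≤ maxN n f
≤-maxN (suc n) f fz = m≤m⊔n (f fz) _
≤-maxN (suc n) f (fs k) = ℕₚ.≤-trans (≤-maxN n (f ∘ fs) k) (m≤n⊔m (f fz) _)

mix-cong : ∀ n {α β : Fin n → ℚ} (E : Fin n → Dist) → (∀ i → α i ≡ β i) →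
           ∀ u → mix n α E u ≡ mix n β E u
mix-cong n E α≗β u = sumQ-cong n (λ i → cong (_* E i u) (α≗β i))

mix-dirac : ∀ n (M : Fin n → Term) → (∀ i j → M i ≡ M j → i ≡ j) →
            (E : Fin n → Dist) → ∀ k u → mix n (λ i → dirac (M k) (M i)) E u ≡ E k u
mix-dirac n M M-injective E k u = begin
  mix n (λ i → dirac (M k) (M i)) E u  ≡⟨ sumQ-single n _ k off-k ⟩
  dirac (M k) (M k) * E k u            ≡⟨ cong (_* E k u) (dirac-self (M k)) ⟩
  1ℚ * E k u                           ≡⟨ *-identityˡ (E k u) ⟩
  E k u                                ∎
  where
  open ≡-Reasoning
  off-k : ∀ i → i ≢ k → dirac (M k) (M i) * E i u ≡ 0ℚ
  off-k i i≢k = trans (cong (_* E i u) (dirac-≢ (λ Mk≡Mi → i≢k (M-injective i k (sym Mk≡Mi)))))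
                      (*-zeroˡ (E i u))

mix-half+ : ∀ n (α β : Fin n → ℚ) (E : Fin n → Dist) u →
            half+ (mix n α E) (mix n β E) u ≡ mix n (λ i → ½ * α i +ℚ ½ * β i) E u
mix-half+ n α β E u = begin
  ½ * mix n α E u +ℚ ½ * mix n β E u
    ≡⟨ cong₂ _+ℚ_ (*-distribˡ-sumQ n ½ _) (*-distribˡ-sumQ n ½ _) ⟩
  sumQ n (λ i → ½ * (α i * E i u)) +ℚ sumQ n (λ i → ½ * (β i * E i u))
    ≡⟨ sym (sumQ-+ n _ _) ⟩
  sumQ n (λ i → ½ * (α i * E i u) +ℚ ½ * (β i * E i u))
    ≡⟨ sumQ-cong n (λ i → sym (factor (α i) (β i) (E i u))) ⟩
  mix n (λ i → ½ * α i +ℚ ½ * β i) E u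
    ∎
  where
  open ≡-Reasoning
  factor : ∀ a b e → (½ * a +ℚ ½ * b) * e ≡ ½ * (a * e) +ℚ ½ * (b * e)
  factor a b e = trans (*-distribʳ-+ e (½ * a) (½ * b)) (cong₂ _+ℚ_ (*-assoc ½ a e) (*-assoc ½ b e))

SupportedOn : ∀ {n} → Dist → (Fin n → Term) → Set
SupportedOn D M = ∀ u → (∀ i → u ≢ M i) → D u ≡ 0ℚ

SupportedOn-half+ : ∀ {n t₁ t₂ D₁ D₂} {M : Fin n → Term} → t₁ ⇒ D₁ → t₂ ⇒ D₂ →
                    SupportedOn (half+ D₁ D₂) M → SupportedOn D₁ M × SupportedOn D₂ M
SupportedOn-half+ {D₁ = D₁} {D₂} {M} π₁ π₂ supp =
  (λ u u∉M → proj₁ (vanish u u∉M)) , (λ u u∉M → proj₂ (vanish u u∉M))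
  where
  vanish : ∀ u → (∀ i → u ≢ M i) → D₁ u ≡ 0ℚ × D₂ u ≡ 0ℚ
  vanish u u∉M = ½+½≡0⇒≡0 (⇒-nonNeg π₁ u) (⇒-nonNeg π₂ u) (supp u u∉M)

⇒-compose : ∀ {t D} (π : t ⇒ D) (n : ℕ) (M : Fin n → Term) →
    (∀ i j → M i ≡ M j → i ≡ j) → SupportedOn D M →
    (E : Fin n → Dist) (ρ : ∀ i → M i ⇒ E i) →
    Σ Dist (λ D′ → Σ (t ⇒ D′) (λ σ →
      (∀ u → D′ u ≡ mix n (λ i → D (M i)) E u) ×
      size σ ≤ size π + maxN n (λ i → size (ρ i))))
⇒-compose (axiom {t}) n M M-injective supp E ρ with any? (λ i → M i ≟ᵀ t)
... | yes (k , refl) = E k , ρ k , (λ u → sym (mix-dirac n M M-injective E k u)) , ≤-maxN n _ k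
... | no t∉M = ⊥-elim (1≢0 (trans (sym (dirac-self t)) (supp t (λ i t≡Mi → t∉M (i , sym t≡Mi)))))
  where
  1≢0 : 1ℚ ≢ 0ℚ
  1≢0 ()
⇒-compose (step1 r π) n M M-injective supp E ρ with ⇒-compose π n M M-injective supp E ρ
... | D′ , σ , σ-value , σ-size = D′ , step1 r σ , σ-value , s≤s σ-size
⇒-compose (step2 {D₁ = D₁} {D₂} r π₁ π₂) n M M-injective supp E ρ
  with SupportedOn-half+ π₁ π₂ supp
... | supp₁ , supp₂
  with ⇒-compose π₁ n M M-injective supp₁ E ρ | ⇒-compose π₂ n M M-injective supp₂ E ρ
... | D₁′ , σ₁ , σ₁-value , σ₁-size | D₂′ , σ₂ , σ₂-value , σ₂-size =
  half+ D₁′ D₂′ , step2 r σ₁ σ₂ , value , s≤s size-bound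
  where
  m : ℕ
  m = maxN n (λ i → size (ρ i))
  value : ∀ u → half+ D₁′ D₂′ u ≡ mix n (λ i → half+ D₁ D₂ (M i)) E u
  value u = trans (cong₂ (λ x y → ½ * x +ℚ ½ * y) (σ₁-value u) (σ₂-value u))
                  (mix-half+ n (D₁ ∘ M) (D₂ ∘ M) E u)
  size-bound : size σ₁ ⊔ size σ₂ ≤ (size π₁ ⊔ size π₂) + m
  size-bound = ℕₚ.≤-trans (⊔-mono-≤ σ₁-size σ₂-size)
                          (ℕₚ.≤-reflexive (sym (+-distribʳ-⊔ m (size π₁) (size π₂))))

mainTheorem16 :
    (t : Term) (D : Dist) (π : t ⇒ D)
    (n : ℕ) (M : Fin n → Term) (α : Fin n → ℚ) →
    (∀ i j → M i ≡ M j → i ≡ j) →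
    (∀ i → 0ℚ < α i) →
    (∀ i → D (M i) ≡ α i) →
    (∀ u → (∀ i → u ≢ M i) → D u ≡ 0ℚ) →
    (E : Fin n → Dist) (ρ : ∀ i → M i ⇒ E i) →
    Σ Dist (λ D' → Σ (t ⇒ D') (λ σ →
      (∀ u → D' u ≡ mix n α E u) ×
      size σ ≤ size π + maxN n (λ i → size (ρ i))))
mainTheorem16 t D π n M α M-injective _ D∘M≡α supp E ρ
  with ⇒-compose π n M M-injective supp E ρ
... | D′ , σ , σ-value , σ-size = D′ , σ , (λ u → trans (σ-value u) (mix-cong n E D∘M≡α u)) , σ-size
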